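{- Let $X'$ and $X''$ be finite sets with $|X'|=|X''|=n\ge3$, and let $\Phi'=(\phi'_n,\dots,\phi'_3)$ and $\Phi''=(\phi''_n,\dots,\phi''_3)$ be admissible sequences on $X'$ and $X''$ respectively. Assume that for every $j=2,\dots,n$ the permutations $\phi'_j$ and $\phi''_j$ have the same cycle type. Then there is a bijection $\Gamma\colon\wp_2(X')\to\wp_2(X'')$ such that $\sigma_{\Phi''}=\Gamma\circ\sigma_{\Phi'}\circ\Gamma^{ -1}$.
   Context: For a set $X$, $\wp_2(X)$ is the set of $2$-element subsets of $X$. Let $|X|=n\ge3$. An admissible sequence on $X$ is a sequence $\Phi=(\phi_n,\phi_{n-1},\dots,\phi_3)$ where each $\phi_j$ is a permutation of a subset $\mathrm{Dom}(\phi_j)\subseteq X$, $|X\setminus \mathrm{Dom}(\phi_n)|=1$, and for $j=n,\dots,4$: $\mathrm{Dom}(\phi_{j-1})\subset\mathrm{Dom}(\phi_j)$ with $|\mathrm{Dom}(\phi_j)\setminus\mathrm{Dom}(\phi_{j-1})|=1$ (so $|\mathrm{Dom}(\phi_j)|=j-1$). Order $X=\{x_n,\dots,x_1\}$ so that $x_j\notin\mathrm{Dom}(\phi_j)$ for $j\ge3$, and let $\phi_2$ be the identity on $\{x_1\}$. Define the permutation $\sigma_\Phi$ of $\wp_2(X)$ by $\sigma_\Phi(\{x_j,x_i\})=\{x_j,\phi_j(x_i)\}$ for $1\le i<j\le n$. -}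

module Defs where

open import Data.Nat using (ℕ; zero; suc; _≤_; _<_; _/_; pred; _≤ᵇ_)
open import Data.Bool using (if_then_else_)
open import Data.Fin using (Fin; toℕ) renaming (_≟_ to _≟ᶠ_)
open import Data.Fin.Subset using (Subset; _∈_; _∉_; _⊂_; ∣_∣; ∁; _─_; ⁅_⁆; _∪_)
open import Data.Fin.Subset.Properties using (_∈?_)
open import Data.List using (length; filter)
open import Data.List.Base using ()
open import Data.Fin.Base using ()
open import Data.List using (List)
open import Data.Vec.Functional using ()
open import Data.Product using (Σ; ∃; _×_; proj₁)
open import Relation.Binary.PropositionalEquality using (_≡_)
open import Relation.Nullary using (does; _×-dec_)
open import Data.Nat.Properties using () renaming (_≟_ to _≟ⁿ_)
open import Function.Definitions using (Bijective)
open import Data.List using ()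
import Data.Fin

allFin : ∀ n → List (Fin n)
allFin n = Data.List.tabulate (λ i → i)

-- f is a permutation of the subset D (values of f outside D are irrelevant):
-- f maps D into D and f restricted to D is a bijection D → D.
IsPermOn : ∀ {n} → Subset n → (Fin n → Fin n) → Set
IsPermOn D f =
  (∀ x → x ∈ D → f x ∈ D) ×
  (∀ x y → x ∈ D → y ∈ D → f x ≡ f y → x ≡ y) ×
  (∀ y → y ∈ D → ∃ λ x → x ∈ D × f x ≡ y)

iter : ∀ {n} → (Fin n → Fin n) → ℕ → Fin n → Fin n
iter f zero x = x
iter f (suc m) x = f (iter f m x)

-- least m ≥ start (within fuel steps) with f^m x = x, 0 if none
minPer : ∀ {n} → (Fin n → Fin n) → Fin n → (fuel start : ℕ) → ℕ
minPer f x zero m = 0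
minPer f x (suc fuel) m =
  if does (iter f m x ≟ᶠ x) then m else minPer f x fuel (suc m)

-- length of the cycle of f through x (for a permutation of a subset of Fin n
-- this is ≤ n, so a search over 1..n finds it)
cycleLen : ∀ {n} → (Fin n → Fin n) → Fin n → ℕ
cycleLen {n} f x = minPer f x n 1

elemsInCyclesOfLen : ∀ {n} → Subset n → (Fin n → Fin n) → ℕ → ℕ
elemsInCyclesOfLen {n} D f k =
  length (filter (λ x → (x ∈? D) ×-dec (cycleLen f x ≟ⁿ k)) (allFin n))

-- cycle type of the permutation f of D, as the function
--   k ↦ number of cycles of length k   (k ≥ 1)
cycleType : ∀ {n} → Subset n → (Fin n → Fin n) → ℕ → ℕ
cycleType D f zero = 0
cycleType D f (suc k) = elemsInCyclesOfLen D f (suc k) / suc k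

SameCycleType : ∀ {n} → Subset n → (Fin n → Fin n) → Subset n → (Fin n → Fin n) → Set
SameCycleType D f E g = ∀ k → cycleType D f k ≡ cycleType E g k

-- An admissible sequence Φ = (φ_n, …, φ_3) on X = Fin n.
-- dom j = Dom(φ_j) and phi j = φ_j for 3 ≤ j ≤ n (values at other j unused).
record Admissible (n : ℕ) : Set where
  field
    dom  : ℕ → Subset n
    phi  : ℕ → Fin n → Fin n
    perm : ∀ j → 3 ≤ j → j ≤ n → IsPermOn (dom j) (phi j)
    top  : ∣ ∁ (dom n) ∣ ≡ 1
    step : ∀ j → 4 ≤ j → j ≤ n →
             (dom (pred j) ⊂ dom j) × (∣ dom j ─ dom (pred j) ∣ ≡ 1)
open Admissible public

-- φ_j with the convention that φ_2 is the identity (on {x_1})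
phiExt : ∀ {n} → Admissible n → ℕ → Fin n → Fin n
phiExt Φ j = if j ≤ᵇ 2 then (λ x → x) else phi Φ j

-- An ordering X = {x_n, …, x_1} compatible with Φ: x : Fin n → Fin n is a
-- bijection, position p (toℕ p = 0 … n-1) holding x_{p+1}, such that
-- x_j ∉ Dom(φ_j) for all 3 ≤ j ≤ n.
IsOrdering : ∀ {n} → Admissible n → (Fin n → Fin n) → Set
IsOrdering Φ x =
  Bijective _≡_ _≡_ x ×
  (∀ p → 3 ≤ suc (toℕ p) → x p ∉ dom Φ (suc (toℕ p)))

℘₂ : ℕ → Set
℘₂ n = Σ (Subset n) (λ s → ∣ s ∣ ≡ 2)

IsSigma : ∀ {n} → (Φ : Admissible n) → (Fin n → Fin n) → (℘₂ n → ℘₂ n) → Set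
IsSigma {n} Φ x σ =
  ∀ (i j : Fin n) → toℕ i < toℕ j → (s : ℘₂ n) →
  proj₁ s ≡ ⁅ x j ⁆ ∪ ⁅ x i ⁆ →
  proj₁ (σ s) ≡ ⁅ x j ⁆ ∪ ⁅ phiExt Φ (suc (toℕ j)) (x i) ⁆

-- σ_Φ fixes the larger point x_j of a pair {x_j, x_i} and moves the smaller one by φ_j.  Recording a
-- pair by the positions of its points, σ_Φ therefore splits into the maps φ_j, each acting on the
-- positions of Dom(φ_j) = {x_1, …, x_{j-1}}.  Permutations of the same cycle type are conjugate (match
-- cycles of equal length one at a time), so each φ′_j is conjugate to φ″_j; transported along the
-- orderings x′ and x″ these conjugacies act on positions, and together they conjugate σ_Φ′ to σ_Φ″.
module Submission where

open import Defs
open import Data.Bool using (Bool; true; false; _∧_; _∨_; not; if_then_else_)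
open import Data.Bool.Properties using (∧-conicalˡ; ∧-conicalʳ)
open import Data.Empty using (⊥-elim)
open import Data.Fin using (Fin; zero; suc; toℕ; fromℕ<) renaming (_≟_ to _≟ᶠ_)
import Data.Fin.Properties as Finₚ
open import Data.Fin.Subset using (Subset; Empty; _∈_; _∉_; _⊆_; ∁; _─_; _-_; _∪_; ⁅_⁆; ∣_∣; inside; outside)
open import Data.Fin.Subset.Properties using (_∈?_; nonempty?; Empty-unique; ∣⊥∣≡0; ∣⁅x⁆∣≡1; x∈⁅x⁆; x∈⁅y⁆⇒x≡y; x∈p∪q⁻; x∈p∪q⁺; ∪-identityˡ; ∪-identityʳ; ∪-comm; ⊆-antisym; p─q⊆p; x∈p∧x≢y⇒x∈p-y; x∈p∧x∉q⇒x∈p─q; x∉p⇒x∈∁p; x∈p⇒∣p-x∣<∣p∣; p⊆q⇒∣p∣≤∣q∣)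
open import Data.List using (length; filter; tabulate)
open import Data.Nat using (ℕ; zero; suc; pred; _+_; _*_; _/_; _∸_; _≤_; _<_; z≤n; s≤s)
open import Data.Nat.DivMod using (m*n/n≡m)
open import Data.Nat.Properties using (+-suc; +-comm; +-identityʳ; +-cancelʳ-≡; +-monoʳ-≤; ≤-refl; ≤-trans; ≤-antisym; ≤-pred; n≤1+n; m≤n+m; m≤m+n; <⇒≤; <⇒≢; <-irrefl; <-asym; <-cmp; ≤-<-trans; ≮⇒≥; _<?_; m≤n⇒m<n∨m≡n; m+[n∸m]≡n; m∸n+n≡m; m<n⇒0<n∸m; m∸n≤m; <-irrelevant; ≡-irrelevant) renaming (_≟_ to _≟ⁿ_)
open import Data.Product using (Σ; ∃; ∃₂; _×_; _,_; proj₁; proj₂)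
open import Data.Sum using (_⊎_; inj₁; inj₂)
import Data.Sum as Sum
open import Data.Vec using (lookup; _∷_; here; there)
open import Data.Vec.Properties using ([]=⇒lookup; lookup⇒[]=)
open import Function using (_∘_; id; _↔_; Inverse; mk⤖; mk↔ₛ′)
open import Function.Consequences.Propositional using (strictlySurjective⇒surjective)
open import Function.Construct.Composition using (_↔-∘_)
open import Function.Construct.Symmetry using (↔-sym)
open import Function.Properties.Bijection using (⤖⇒↔)
open import Relation.Binary using (tri<; tri≈; tri>)
open import Relation.Binary.PropositionalEquality
open import Relation.Nullary using (Dec; does; yes; no; _×-dec_)
open import Relation.Nullary.Decidable using (dec-true; dec-false)
open import Relation.Unary using (Pred; Decidable; _≐_)

count : ∀ {n} → (Fin n → Bool) → ℕ
count {zero}  b = 0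
count {suc n} b = (if b zero then 1 else 0) + count (b ∘ suc)

count-cong : ∀ {n} {b c : Fin n → Bool} → (∀ z → b z ≡ c z) → count b ≡ count c
count-cong {zero}  eq = refl
count-cong {suc n} eq = cong₂ _+_ (cong (λ v → if v then 1 else 0) (eq zero)) (count-cong (eq ∘ suc))

count-∨ : ∀ {n} (b c : Fin n → Bool) → (∀ z → b z ∧ c z ≡ false) →
          count (λ z → b z ∨ c z) ≡ count b + count c
count-∨ {zero}  b c disj = refl
count-∨ {suc n} b c disj with b zero | c zero | disj zero | count-∨ (b ∘ suc) (c ∘ suc) (disj ∘ suc)
... | true  | true  | () | _
... | true  | false | _  | ih = cong suc ih
... | false | true  | _  | ih = trans (cong suc ih) (sym (+-suc _ _))
... | false | false | _  | ih = ih

count-split : ∀ {n} (b c : Fin n → Bool) →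
              count b ≡ count (λ z → b z ∧ c z) + count (λ z → b z ∧ not (c z))
count-split {zero}  b c = refl
count-split {suc n} b c with b zero | c zero | count-split (b ∘ suc) (c ∘ suc)
... | true  | true  | ih = cong suc ih
... | true  | false | ih = trans (cong suc ih) (sym (+-suc _ _))
... | false | true  | ih = ih
... | false | false | ih = ih

count-∧-const : ∀ {n} (b : Fin n → Bool) c → count (λ z → b z ∧ c) ≡ (if c then count b else 0)
count-∧-const {zero}  b true  = refl
count-∧-const {zero}  b false = refl
count-∧-const {suc n} b true  with b zero
... | true  = cong suc (count-∧-const (b ∘ suc) true)
... | false = count-∧-const (b ∘ suc) true
count-∧-const {suc n} b false with b zero
... | true  = count-∧-const (b ∘ suc) false
... | false = count-∧-const (b ∘ suc) false

count-false : ∀ n → count {n} (λ _ → false) ≡ 0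
count-false zero    = refl
count-false (suc n) = count-false n

count-≟ : ∀ {n} (a : Fin n) → count (λ z → does (a ≟ᶠ z)) ≡ 1
count-≟ {suc n} zero    = cong suc (trans (count-cong {n} (λ _ → refl)) (count-false n))
count-≟ {suc n} (suc a) = count-≟ a

count≡0 : ∀ {n} (b : Fin n → Bool) → count b ≡ 0 → ∀ z → b z ≡ false
count≡0 {suc n} b eq z with b zero in eb
count≡0 {suc n} b ()  z       | true
count≡0 {suc n} b eq  zero    | false = eb
count≡0 {suc n} b eq  (suc z) | false = count≡0 (b ∘ suc) eq z

count>0 : ∀ {n} (b : Fin n → Bool) {z} → b z ≡ true → 1 ≤ count b
count>0 b {z} bz with count b in eq
... | suc _ = s≤s z≤n
... | zero with () ← trans (sym bz) (count≡0 b eq z)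

witness : ∀ {n} (b : Fin n → Bool) → 1 ≤ count b → ∃ λ z → b z ≡ true
witness {suc n} b pos with b zero in eb
... | true  = zero , eb
... | false with witness (b ∘ suc) pos
... | z , bz = suc z , bz

iter-+ : ∀ {n} (f : Fin n → Fin n) a b x → iter f (a + b) x ≡ iter f a (iter f b x)
iter-+ f zero    b x = refl
iter-+ f (suc a) b x = cong f (iter-+ f a b x)

iter-comm : ∀ {n} (f : Fin n → Fin n) a b x → iter f a (iter f b x) ≡ iter f b (iter f a x)
iter-comm f a b x = begin
  iter f a (iter f b x) ≡⟨ iter-+ f a b x ⟨
  iter f (a + b) x      ≡⟨ cong (λ k → iter f k x) (+-comm a b) ⟩
  iter f (b + a) x      ≡⟨ iter-+ f b a x ⟩
  iter f b (iter f a x) ∎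
  where open ≡-Reasoning

minPer-spec : ∀ {n} (f : Fin n → Fin n) x fuel s t → s ≤ t → t < s + fuel → iter f t x ≡ x →
  let r = minPer f x fuel s in
  s ≤ r × r ≤ t × iter f r x ≡ x × (∀ u → s ≤ u → u < r → iter f u x ≢ x)
minPer-spec f x zero s t s≤t t<s+0 _ with () ← <-irrefl refl (≤-<-trans s≤t (subst (t <_) (+-comm s 0) t<s+0))
minPer-spec f x (suc fuel) s t s≤t t<s+fuel fixed with iter f s x ≟ᶠ x
... | yes fs = ≤-refl , s≤t , fs , λ u s≤u u<s → ⊥-elim (<-irrefl refl (≤-<-trans s≤u u<s))
... | no ¬fs with m≤n⇒m<n∨m≡n s≤t
...   | inj₂ refl = ⊥-elim (¬fs fixed)
...   | inj₁ s<t with minPer-spec f x fuel (suc s) t s<t (subst (t <_) (+-suc s fuel) t<s+fuel) fixed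
...     | s<r , r≤t , fr , least = <⇒≤ s<r , r≤t , fr , least′
  where
  least′ : ∀ u → s ≤ u → u < minPer f x fuel (suc s) → iter f u x ≢ x
  least′ u s≤u u<r with m≤n⇒m<n∨m≡n s≤u
  ... | inj₂ refl = ¬fs
  ... | inj₁ s<u  = least u s<u u<r

minPer-cong : ∀ {n} (f g : Fin n → Fin n) x y fuel s →
  (∀ t → iter f t x ≡ x → iter g t y ≡ y) → (∀ t → iter g t y ≡ y → iter f t x ≡ x) →
  minPer f x fuel s ≡ minPer g y fuel s
minPer-cong f g x y zero       s ⇒ ⇐ = refl
minPer-cong f g x y (suc fuel) s ⇒ ⇐ with iter f s x ≟ᶠ x | iter g s y ≟ᶠ y
... | yes _  | yes _  = refl
... | yes fs | no ¬gs = ⊥-elim (¬gs (⇒ s fs))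
... | no ¬fs | yes gs = ⊥-elim (¬fs (⇐ s gs))
... | no _   | no _   = minPer-cong f g x y fuel (suc s) ⇒ ⇐

⟦_⟧ : ∀ {n} → (Fin n → Bool) → Fin n → Set
⟦ d ⟧ z = d z ≡ true

orbit : ∀ {n} → (Fin n → Fin n) → Fin n → ℕ → Fin n → Bool
orbit f x zero    z = false
orbit f x (suc m) z = orbit f x m z ∨ does (iter f m x ≟ᶠ z)

∈orbit⇒iter : ∀ {n} (f : Fin n → Fin n) x m z → orbit f x m z ≡ true → ∃ λ i → i < m × iter f i x ≡ z
∈orbit⇒iter f x (suc m) z oz with orbit f x m z in eq
... | true with ∈orbit⇒iter f x m z eq
...   | i , i<m , fi = i , ≤-trans i<m (n≤1+n _) , fi
∈orbit⇒iter f x (suc m) z oz | false with iter f m x ≟ᶠ z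
...   | yes fm = m , ≤-refl , fm

iter∈orbit : ∀ {n} (f : Fin n → Fin n) x m i → i < m → orbit f x m (iter f i x) ≡ true
iter∈orbit f x (suc m) i (s≤s i≤m) with m≤n⇒m<n∨m≡n i≤m
... | inj₁ i<m rewrite iter∈orbit f x m i i<m = refl
... | inj₂ refl with iter f i x ≟ᶠ iter f i x
...   | no ¬refl = ⊥-elim (¬refl refl)
...   | yes _ with orbit f x i (iter f i x)
...     | true  = refl
...     | false = refl

∉orbit : ∀ {n} (f : Fin n → Fin n) x m z → (∀ i → i < m → iter f i x ≢ z) → orbit f x m z ≡ false
∉orbit f x zero    z _ = refl
∉orbit f x (suc m) z avoid rewrite ∉orbit f x m z (λ i i<m → avoid i (≤-trans i<m (n≤1+n _)))
  with iter f m x ≟ᶠ z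
... | yes fm = ⊥-elim (avoid m ≤-refl fm)
... | no _   = refl

orbitMap : ∀ {n} → (Fin n → Fin n) → Fin n → (Fin n → Fin n) → Fin n → ℕ → Fin n → Fin n
orbitMap f x g y zero    z = z
orbitMap f x g y (suc m) z = if orbit f x m z then orbitMap f x g y m z else iter g m y

record IsCycle {n} (f : Fin n → Fin n) (x : Fin n) (m : ℕ) : Set where
  field
    nonempty : 1 ≤ m
    closes   : iter f m x ≡ x
    distinct : ∀ i j → i < j → j < m → iter f i x ≢ iter f j x

record Conjugacy {n} (P Q : Fin n → Set) (f g : Fin n → Fin n) : Set where
  field
    to from : Fin n → Fin n
    to-∈    : ∀ z → P z → Q (to z)
    from-∈  : ∀ w → Q w → P (from w)
    from-to : ∀ z → P z → from (to z) ≡ z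
    to-from : ∀ w → Q w → to (from w) ≡ w
    to-comm : ∀ z → P z → to (f z) ≡ g (to z)

module Cycle {n} {f : Fin n → Fin n} {x : Fin n} {m : ℕ} (C : IsCycle f x m) where
  open IsCycle C

  fresh : ∀ i → i < m → orbit f x i (iter f i x) ≡ false
  fresh i i<m = ∉orbit f x i _ (λ j j<i → distinct j i j<i i<m)

  orbitMap-iter : ∀ g y i → i < m → orbitMap f x g y m (iter f i x) ≡ iter g i y
  orbitMap-iter g y i = go m ≤-refl
    where
    go : ∀ k → k ≤ m → i < k → orbitMap f x g y k (iter f i x) ≡ iter g i y
    go (suc k) k<m (s≤s i≤k) with m≤n⇒m<n∨m≡n i≤k
    ... | inj₁ i<k rewrite iter∈orbit f x k i i<k = go k (<⇒≤ k<m) i<k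
    ... | inj₂ refl rewrite fresh i k<m = refl

  count-orbit : count (orbit f x m) ≡ m
  count-orbit = go m ≤-refl
    where
    go : ∀ k → k ≤ m → count (orbit f x k) ≡ k
    go zero    _   = count-false n
    go (suc k) k<m = begin
      count (orbit f x (suc k))                                     ≡⟨ count-∨ _ _ disjoint ⟩
      count (orbit f x k) + count (λ z → does (iter f k x ≟ᶠ z))    ≡⟨ cong₂ _+_ (go k (<⇒≤ k<m)) (count-≟ (iter f k x)) ⟩
      k + 1                                                         ≡⟨ +-comm k 1 ⟩
      suc k                                                         ∎
      where
      open ≡-Reasoning
      disjoint : ∀ z → orbit f x k z ∧ does (iter f k x ≟ᶠ z) ≡ false
      disjoint z with iter f k x ≟ᶠ z
      ... | yes refl rewrite fresh k k<m = refl
      ... | no _ with orbit f x k z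
      ...   | true  = refl
      ...   | false = refl

  wraps : ∀ i → suc i ≡ m → f (iter f i x) ≡ x
  wraps i refl = closes

  orbit-closed : ∀ z → orbit f x m z ≡ true → orbit f x m (f z) ≡ true
  orbit-closed z oz with ∈orbit⇒iter f x m z oz
  ... | i , i<m , refl with m≤n⇒m<n∨m≡n i<m
  ...   | inj₁ si<m = iter∈orbit f x m (suc i) si<m
  ...   | inj₂ si≡m rewrite wraps i si≡m = iter∈orbit f x m 0 nonempty

  preimage : ∀ i → i < m → ∃ λ w → orbit f x m w ≡ true × f w ≡ iter f i x
  preimage (suc i) si<m = iter f i x , iter∈orbit f x m i (≤-trans (n≤1+n _) si<m) , refl
  preimage zero    _    = iter f (pred m) x , iter∈orbit f x m (pred m) pred<m , wraps (pred m) (suc-pred nonempty)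
    where
    suc-pred : ∀ {k} → 1 ≤ k → suc (pred k) ≡ k
    suc-pred (s≤s _) = refl
    pred<m : pred m < m
    pred<m = subst (pred m <_) (suc-pred nonempty) ≤-refl

cycles-conjugate : ∀ {n} {f g : Fin n → Fin n} {x y m} → IsCycle f x m → IsCycle g y m →
                   Conjugacy ⟦ orbit f x m ⟧ ⟦ orbit g y m ⟧ f g
cycles-conjugate {n} {f} {g} {x} {y} {m} C D = record
  { to      = orbitMap f x g y m
  ; from    = orbitMap g y f x m
  ; to-∈    = λ z oz → on-orbit f x oz λ i i<m →
                subst ⟦ orbit g y m ⟧ (sym (to-iter i i<m)) (iter∈orbit g y m i i<m)
  ; from-∈  = λ w ow → on-orbit g y ow λ i i<m →
                subst ⟦ orbit f x m ⟧ (sym (from-iter i i<m)) (iter∈orbit f x m i i<m)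
  ; from-to = λ z oz → on-orbit f x oz λ i i<m →
                trans (cong (orbitMap g y f x m) (to-iter i i<m)) (from-iter i i<m)
  ; to-from = λ w ow → on-orbit g y ow λ i i<m →
                trans (cong (orbitMap f x g y m) (from-iter i i<m)) (to-iter i i<m)
  ; to-comm = λ z oz → on-orbit f x oz comm
  }
  where
  module C = Cycle C
  module D = Cycle D

  to-iter : ∀ i → i < m → orbitMap f x g y m (iter f i x) ≡ iter g i y
  to-iter = C.orbitMap-iter g y
  from-iter : ∀ i → i < m → orbitMap g y f x m (iter g i y) ≡ iter f i x
  from-iter = D.orbitMap-iter f x

  on-orbit : ∀ h w {P : Fin n → Set} {z} → orbit h w m z ≡ true → (∀ i → i < m → P (iter h i w)) → P z
  on-orbit h w {z = z} oz p with ∈orbit⇒iter h w m z oz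
  ... | i , i<m , refl = p i i<m

  comm : ∀ i → i < m → orbitMap f x g y m (f (iter f i x)) ≡ g (orbitMap f x g y m (iter f i x))
  comm i i<m with m≤n⇒m<n∨m≡n i<m
  ... | inj₁ si<m = trans (to-iter (suc i) si<m) (cong g (sym (to-iter i i<m)))
  ... | inj₂ si≡m = begin
    orbitMap f x g y m (f (iter f i x)) ≡⟨ cong (orbitMap f x g y m) (C.wraps i si≡m) ⟩
    orbitMap f x g y m x                ≡⟨ to-iter 0 (IsCycle.nonempty C) ⟩
    y                                   ≡⟨ D.wraps i si≡m ⟨
    g (iter g i y)                      ≡⟨ cong g (to-iter i i<m) ⟨
    g (orbitMap f x g y m (iter f i x)) ∎
    where open ≡-Reasoning

-- Removing one cycle at a time

-- On a finite set an injective self-map is a permutation.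
record IsInjectiveOn {n} (d : Fin n → Bool) (f : Fin n → Fin n) : Set where
  field
    into      : ∀ z → d z ≡ true → d (f z) ≡ true
    injective : ∀ z w → d z ≡ true → d w ≡ true → f z ≡ f w → z ≡ w

_∖_ : ∀ {n} → (Fin n → Bool) → (Fin n → Bool) → Fin n → Bool
(d ∖ e) z = d z ∧ not (e z)

∖-intro : ∀ {n} (d e : Fin n → Bool) {z} → d z ≡ true → e z ≡ false → (d ∖ e) z ≡ true
∖-intro d e dz ez rewrite dz | ez = refl

∖-elim : ∀ {n} (d e : Fin n → Bool) z → (d ∖ e) z ≡ true → d z ≡ true × e z ≡ false
∖-elim d e z de with d z | e z
... | true | false = refl , refl

if-≟-then-≡ : ∀ {m k} (m≟k : Dec (m ≡ k)) → (if does m≟k then m else 0) ≡ (if does m≟k then k else 0)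
if-≟-then-≡ (yes m≡k) = m≡k
if-≟-then-≡ (no _)    = refl

*-+-if : ∀ (b : Bool) c k → c * k + (if b then k else 0) ≡ (if b then suc c else c) * k
*-+-if true  c k = +-comm (c * k) k
*-+-if false c k = +-identityʳ (c * k)

onCyclesOfLen : ∀ {n} → (Fin n → Bool) → (Fin n → Fin n) → ℕ → Fin n → Bool
onCyclesOfLen d f k z = d z ∧ does (cycleLen f z ≟ⁿ k)

module InjectiveOn {n} {d : Fin n → Bool} {f : Fin n → Fin n} (I : IsInjectiveOn d f) where
  open IsInjectiveOn I

  iter-into : ∀ i x → d x ≡ true → d (iter f i x) ≡ true
  iter-into zero    x dx = dx
  iter-into (suc i) x dx = into _ (iter-into i x dx)

  iter-injective : ∀ i x y → d x ≡ true → d y ≡ true → iter f i x ≡ iter f i y → x ≡ y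
  iter-injective zero    x y dx dy e = e
  iter-injective (suc i) x y dx dy e = iter-injective i x y dx dy (injective _ _ (iter-into i x dx) (iter-into i y dy) e)

  iter-gap : ∀ x → d x ≡ true → ∀ i j → i < j → iter f i x ≡ iter f j x → iter f (j ∸ i) x ≡ x
  iter-gap x dx i j i<j fi≡fj = iter-injective i _ _ (iter-into (j ∸ i) x dx) dx (begin
    iter f i (iter f (j ∸ i) x) ≡⟨ iter-+ f i (j ∸ i) x ⟨
    iter f (i + (j ∸ i)) x      ≡⟨ cong (λ k → iter f k x) (m+[n∸m]≡n (<⇒≤ i<j)) ⟩
    iter f j x                  ≡⟨ fi≡fj ⟨
    iter f i x                  ∎)
    where open ≡-Reasoning

  period : ∀ x → d x ≡ true → ∃ λ t → 1 ≤ t × t ≤ n × iter f t x ≡ x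
  period x dx with Finₚ.pigeonhole ≤-refl (λ (i : Fin (suc n)) → iter f (toℕ i) x)
  ... | i , j , i<j , fi≡fj =
    toℕ j ∸ toℕ i , m<n⇒0<n∸m i<j , ≤-trans (m∸n≤m (toℕ j) (toℕ i)) (≤-pred (Finₚ.toℕ<n j)) ,
    iter-gap x dx (toℕ i) (toℕ j) i<j fi≡fj

  isCycle : ∀ x → d x ≡ true → IsCycle f x (cycleLen f x)
  isCycle x dx with period x dx
  ... | t , 1≤t , t≤n , ft with minPer-spec f x n 1 t 1≤t (s≤s t≤n) ft
  ...   | 1≤m , _ , fm , least = record
    { nonempty = 1≤m
    ; closes   = fm
    ; distinct = λ i j i<j j<m fi≡fj →
        least (j ∸ i) (m<n⇒0<n∸m i<j) (≤-<-trans (m∸n≤m j i) j<m) (iter-gap x dx i j i<j fi≡fj)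
    }

  cycleLen-iter : ∀ x → d x ≡ true → ∀ i → cycleLen f (iter f i x) ≡ cycleLen f x
  cycleLen-iter x dx i = minPer-cong f f (iter f i x) x n 1 ⇒ ⇐
    where
    ⇒ : ∀ t → iter f t (iter f i x) ≡ iter f i x → iter f t x ≡ x
    ⇒ t e = iter-injective i _ _ (iter-into t x dx) dx (trans (iter-comm f i t x) e)
    ⇐ : ∀ t → iter f t x ≡ x → iter f t (iter f i x) ≡ iter f i x
    ⇐ t e = trans (sym (iter-comm f i t x)) (cong (iter f i) e)

  module Orbit (x : Fin n) (dx : d x ≡ true) where
    m : ℕ
    m = cycleLen f x

    O : Fin n → Bool
    O = orbit f x m

    module C = Cycle (isCycle x dx)

    O⊆d : ∀ z → O z ≡ true → d z ≡ true
    O⊆d z oz with ∈orbit⇒iter f x m z oz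
    ... | i , _ , refl = iter-into i x dx

    cycleLen-O : ∀ z → O z ≡ true → cycleLen f z ≡ m
    cycleLen-O z oz with ∈orbit⇒iter f x m z oz
    ... | i , _ , refl = cycleLen-iter x dx i

    f⁻¹O⊆O : ∀ z → d z ≡ true → O (f z) ≡ true → O z ≡ true
    f⁻¹O⊆O z dz ofz with ∈orbit⇒iter f x m (f z) ofz
    ... | i , i<m , fi≡fz with C.preimage i i<m
    ...   | w , ow , fw≡fi =
      subst (λ v → O v ≡ true) (injective w z (O⊆d w ow) dz (trans fw≡fi fi≡fz)) ow

    rest-injective : IsInjectiveOn (d ∖ O) f
    rest-injective = record
      { into      = λ z r → let (dz , ¬oz) = ∖-elim d O z r in ∖-intro d O (into z dz) (stays-out z dz ¬oz)
      ; injective = λ z w rz rw → injective z w (proj₁ (∖-elim d O z rz)) (proj₁ (∖-elim d O w rw))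
      }
      where
      stays-out : ∀ z → d z ≡ true → O z ≡ false → O (f z) ≡ false
      stays-out z dz ¬oz with O (f z) in ofz
      ... | false = refl
      ... | true with () ← trans (sym (f⁻¹O⊆O z dz ofz)) ¬oz

    count-∖O : ∀ (b : Fin n → Bool) → count b ≡ count (b ∖ O) + count (λ z → b z ∧ O z)
    count-∖O b = trans (count-split b O) (+-comm (count (λ z → b z ∧ O z)) (count (b ∖ O)))

    count-rest : count d ≡ count (d ∖ O) + m
    count-rest = trans (count-∖O d) (cong (count (d ∖ O) +_) (trans (count-cong in-d) C.count-orbit))
      where
      in-d : ∀ z → d z ∧ O z ≡ O z
      in-d z with O z in oz
      ... | true  rewrite O⊆d z oz = refl
      ... | false with d z
      ...   | true  = refl
      ...   | false = refl

    count-rest< : count (d ∖ O) < count d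
    count-rest< = subst₂ _≤_ (+-comm (count (d ∖ O)) 1) (sym count-rest)
                         (+-monoʳ-≤ (count (d ∖ O)) (IsCycle.nonempty (isCycle x dx)))

    countOnCycles-rest : ∀ k → count (onCyclesOfLen d f k) ≡
                         count (onCyclesOfLen (d ∖ O) f k) + (if does (m ≟ⁿ k) then k else 0)
    countOnCycles-rest k = begin
      count (onCyclesOfLen d f k)
        ≡⟨ count-∖O _ ⟩
      count (onCyclesOfLen d f k ∖ O) + count (λ z → onCyclesOfLen d f k z ∧ O z)
        ≡⟨ cong₂ _+_ (count-cong off-O) (count-cong on-O) ⟩
      count (onCyclesOfLen (d ∖ O) f k) + count (λ z → O z ∧ does (m ≟ⁿ k))
        ≡⟨ cong (count (onCyclesOfLen (d ∖ O) f k) +_) (count-∧-const O (does (m ≟ⁿ k))) ⟩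
      count (onCyclesOfLen (d ∖ O) f k) + (if does (m ≟ⁿ k) then count O else 0)
        ≡⟨ cong (λ c → count (onCyclesOfLen (d ∖ O) f k) + (if does (m ≟ⁿ k) then c else 0)) C.count-orbit ⟩
      count (onCyclesOfLen (d ∖ O) f k) + (if does (m ≟ⁿ k) then m else 0)
        ≡⟨ cong (count (onCyclesOfLen (d ∖ O) f k) +_) (if-≟-then-≡ (m ≟ⁿ k)) ⟩
      count (onCyclesOfLen (d ∖ O) f k) + (if does (m ≟ⁿ k) then k else 0)
        ∎
      where
      open ≡-Reasoning
      off-O : ∀ z → (onCyclesOfLen d f k ∖ O) z ≡ onCyclesOfLen (d ∖ O) f k z
      off-O z with d z | does (cycleLen f z ≟ⁿ k) | O z
      ... | true  | true  | true  = refl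
      ... | true  | true  | false = refl
      ... | true  | false | true  = refl
      ... | true  | false | false = refl
      ... | false | _     | _     = refl
      on-O : ∀ z → onCyclesOfLen d f k z ∧ O z ≡ O z ∧ does (m ≟ⁿ k)
      on-O z with O z in oz
      ... | true  rewrite O⊆d z oz | cycleLen-O z oz with does (m ≟ⁿ k)
      ...   | true  = refl
      ...   | false = refl
      on-O z | false with onCyclesOfLen d f k z
      ...   | true  = refl
      ...   | false = refl

orbit-induction : ∀ {n} {f : Fin n → Fin n} (P : (Fin n → Bool) → Set) →
  (∀ d → (∀ z → d z ≡ false) → P d) →
  (∀ d (I : IsInjectiveOn d f) x (dx : d x ≡ true) → P (d ∖ orbit f x (cycleLen f x)) → P d) →
  ∀ d → IsInjectiveOn d f → P d
orbit-induction {f = f} P empty remove d I = go (count d) d I ≤-refl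
  where
  go : ∀ F d → IsInjectiveOn d f → count d ≤ F → P d
  go F d I le with count d in cd
  ... | zero = empty d (count≡0 d cd)
  go zero    d I () | suc _
  go (suc F) d I (s≤s c≤F) | suc c with witness d (subst (1 ≤_) (sym cd) (s≤s z≤n))
  ... | x , dx = remove d I x dx (go F _ O.rest-injective shrinks)
    where
    module O = InjectiveOn.Orbit I x dx
    shrinks : count (d ∖ O.O) ≤ F
    shrinks = ≤-pred (≤-trans O.count-rest< (subst (_≤ suc F) (sym cd) (s≤s c≤F)))

Conjugacy-∅ : ∀ {n} {d e : Fin n → Bool} {f g : Fin n → Fin n} →
              (∀ z → d z ≡ false) → (∀ w → e w ≡ false) → Conjugacy ⟦ d ⟧ ⟦ e ⟧ f g
Conjugacy-∅ {n} {d} {e} d∅ e∅ = record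
  { to = λ z → z ; from = λ w → w
  ; to-∈ = ∉d ; from-∈ = ∉e ; from-to = ∉d ; to-from = ∉e ; to-comm = ∉d }
  where
  ∉d : ∀ {A : Fin n → Set} z → d z ≡ true → A z
  ∉d z dz with () ← trans (sym dz) (d∅ z)
  ∉e : ∀ {A : Fin n → Set} w → e w ≡ true → A w
  ∉e w ew with () ← trans (sym ew) (e∅ w)

Conjugacy-glue : ∀ {n} {d e O O′ : Fin n → Bool} {f g : Fin n → Fin n} →
  (∀ z → O z ≡ true → d z ≡ true) → (∀ w → O′ w ≡ true → e w ≡ true) →
  (∀ z → O z ≡ true → O (f z) ≡ true) → (∀ z → (d ∖ O) z ≡ true → (d ∖ O) (f z) ≡ true) →
  Conjugacy ⟦ O ⟧ ⟦ O′ ⟧ f g → Conjugacy ⟦ d ∖ O ⟧ ⟦ e ∖ O′ ⟧ f g → Conjugacy ⟦ d ⟧ ⟦ e ⟧ f g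
Conjugacy-glue {n} {d} {e} {O} {O′} {f} {g} O⊆d O′⊆e O-closed rest-closed A B = record
  { to = to ; from = from ; to-∈ = to-∈ ; from-∈ = from-∈ ; from-to = from-to ; to-from = to-from ; to-comm = to-comm }
  where
  module A = Conjugacy A
  module B = Conjugacy B

  to from : Fin n → Fin n
  to   z = if O  z then A.to   z else B.to   z
  from w = if O′ w then A.from w else B.from w

  to-∈ : ∀ z → d z ≡ true → e (to z) ≡ true
  to-∈ z dz with O z in oz
  ... | true  = O′⊆e _ (A.to-∈ z oz)
  ... | false = proj₁ (∖-elim e O′ _ (B.to-∈ z (∖-intro d O dz oz)))

  from-∈ : ∀ w → e w ≡ true → d (from w) ≡ true
  from-∈ w ew with O′ w in ow
  ... | true  = O⊆d _ (A.from-∈ w ow)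
  ... | false = proj₁ (∖-elim d O _ (B.from-∈ w (∖-intro e O′ ew ow)))

  from-to : ∀ z → d z ≡ true → from (to z) ≡ z
  from-to z dz with O z in oz
  ... | true  rewrite A.to-∈ z oz = A.from-to z oz
  ... | false rewrite proj₂ (∖-elim e O′ _ (B.to-∈ z (∖-intro d O dz oz))) = B.from-to z (∖-intro d O dz oz)

  to-from : ∀ w → e w ≡ true → to (from w) ≡ w
  to-from w ew with O′ w in ow
  ... | true  rewrite A.from-∈ w ow = A.to-from w ow
  ... | false rewrite proj₂ (∖-elim d O _ (B.from-∈ w (∖-intro e O′ ew ow))) = B.to-from w (∖-intro e O′ ew ow)

  to-comm : ∀ z → d z ≡ true → to (f z) ≡ g (to z)
  to-comm z dz with O z in oz
  ... | true  rewrite O-closed z oz = A.to-comm z oz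
  ... | false rewrite proj₂ (∖-elim d O _ (rest-closed z (∖-intro d O dz oz))) = B.to-comm z (∖-intro d O dz oz)

Conjugacy-id : ∀ {n} {P : Fin n → Set} {f g : Fin n → Fin n} →
               (∀ z → P z → f z ≡ z) → (∀ z → P z → g z ≡ z) → Conjugacy P P f g
Conjugacy-id f≗id g≗id = record
  { to = id ; from = id ; to-∈ = λ _ p → p ; from-∈ = λ _ p → p
  ; from-to = λ _ _ → refl ; to-from = λ _ _ → refl ; to-comm = λ z p → trans (f≗id z p) (sym (g≗id z p)) }

Conjugacy-resp : ∀ {n} {P P′ Q Q′ : Fin n → Set} {f f′ g g′ : Fin n → Fin n} →
  P′ ≐ P → Q′ ≐ Q → (∀ z → P z → f′ z ≡ f z) → (∀ w → Q w → g′ w ≡ g w) →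
  Conjugacy P Q f g → Conjugacy P′ Q′ f′ g′
Conjugacy-resp {f = f} {f′} {g} {g′} (P′⊆P , P⊆P′) (Q′⊆Q , Q⊆Q′) f′≗f g′≗g C = record
  { to      = to
  ; from    = from
  ; to-∈    = λ z p → Q⊆Q′ (to-∈ z (P′⊆P p))
  ; from-∈  = λ w q → P⊆P′ (from-∈ w (Q′⊆Q q))
  ; from-to = λ z p → from-to z (P′⊆P p)
  ; to-from = λ w q → to-from w (Q′⊆Q q)
  ; to-comm = λ z p → let p = P′⊆P p in
      trans (cong to (f′≗f z p)) (trans (to-comm z p) (sym (g′≗g (to z) (to-∈ z p))))
  }
  where open Conjugacy C

Conjugacy-relabel : ∀ {n} {P Q : Fin n → Set} {f g : Fin n → Fin n} (π ρ : Fin n ↔ Fin n) →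
  Conjugacy P Q f g →
  Conjugacy (P ∘ Inverse.to π) (Q ∘ Inverse.to ρ) (Inverse.from π ∘ f ∘ Inverse.to π) (Inverse.from ρ ∘ g ∘ Inverse.to ρ)
Conjugacy-relabel {P = P} {Q} {f} {g} π ρ C = record
  { to      = ρ.from ∘ to ∘ π.to
  ; from    = π.from ∘ from ∘ ρ.to
  ; to-∈    = λ z p → subst Q (sym (ρ.strictlyInverseˡ _)) (to-∈ _ p)
  ; from-∈  = λ w q → subst P (sym (π.strictlyInverseˡ _)) (from-∈ _ q)
  ; from-to = λ z p → begin
      π.from (from (ρ.to (ρ.from (to (π.to z))))) ≡⟨ cong (π.from ∘ from) (ρ.strictlyInverseˡ _) ⟩
      π.from (from (to (π.to z)))                 ≡⟨ cong π.from (from-to _ p) ⟩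
      π.from (π.to z)                             ≡⟨ π.strictlyInverseʳ z ⟩
      z                                           ∎
  ; to-from = λ w q → begin
      ρ.from (to (π.to (π.from (from (ρ.to w))))) ≡⟨ cong (ρ.from ∘ to) (π.strictlyInverseˡ _) ⟩
      ρ.from (to (from (ρ.to w)))                 ≡⟨ cong ρ.from (to-from _ q) ⟩
      ρ.from (ρ.to w)                             ≡⟨ ρ.strictlyInverseʳ w ⟩
      w                                           ∎
  ; to-comm = λ z p → begin
      ρ.from (to (π.to (π.from (f (π.to z))))) ≡⟨ cong (ρ.from ∘ to) (π.strictlyInverseˡ _) ⟩
      ρ.from (to (f (π.to z)))                 ≡⟨ cong ρ.from (to-comm _ p) ⟩
      ρ.from (g (to (π.to z)))                 ≡⟨ cong (ρ.from ∘ g) (ρ.strictlyInverseˡ _) ⟨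
      ρ.from (g (ρ.to (ρ.from (to (π.to z))))) ∎
  }
  where
  open Conjugacy C
  open ≡-Reasoning
  module π = Inverse π
  module ρ = Inverse ρ

-- Permutations with equal cycle counts are conjugate

≟ⁿ-sound : ∀ {a b} → does (a ≟ⁿ b) ≡ true → a ≡ b
≟ⁿ-sound {a} {b} eq with a ≟ⁿ b
... | yes a≡b = a≡b
... | no a≢b with () ← trans (sym eq) (dec-false (a ≟ⁿ b) a≢b)

matching-cycle : ∀ {n} {d e : Fin n → Bool} {f g : Fin n → Fin n} →
  (∀ k → count (onCyclesOfLen e g k) ≡ count (onCyclesOfLen d f k)) →
  ∀ y → e y ≡ true → ∃ λ x → d x ≡ true × cycleLen f x ≡ cycleLen g y
matching-cycle {d = d} {e} {f} {g} same y ey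
  with witness (onCyclesOfLen d f (cycleLen g y)) (subst (1 ≤_) (same _) y-counted)
  where
  y-counted : 1 ≤ count (onCyclesOfLen e g (cycleLen g y))
  y-counted = count>0 _ {y} (trans (cong (_∧ _) ey) (dec-true (cycleLen g y ≟ⁿ cycleLen g y) refl))
... | x , x-counted = x , ∧-conicalˡ _ _ x-counted , ≟ⁿ-sound (∧-conicalʳ _ _ x-counted)

sameCycleCounts⇒Conjugacy : ∀ {n} {d e : Fin n → Bool} {f g : Fin n → Fin n} →
  IsInjectiveOn d f → IsInjectiveOn e g →
  (∀ k → count (onCyclesOfLen d f k) ≡ count (onCyclesOfLen e g k)) → Conjugacy ⟦ d ⟧ ⟦ e ⟧ f g
sameCycleCounts⇒Conjugacy {n} {d} {e} {f} {g} I J = orbit-induction P empty remove d I e J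
  where
  P : (Fin n → Bool) → Set
  P d = ∀ e → IsInjectiveOn e g → (∀ k → count (onCyclesOfLen d f k) ≡ count (onCyclesOfLen e g k)) →
        Conjugacy ⟦ d ⟧ ⟦ e ⟧ f g

  empty : ∀ d → (∀ z → d z ≡ false) → P d
  empty d d∅ e J same = Conjugacy-∅ d∅ e∅
    where
    e∅ : ∀ w → e w ≡ false
    e∅ w with e w in ew
    ... | false = refl
    ... | true with matching-cycle (sym ∘ same) w ew
    ...   | x , dx , _ with () ← trans (sym dx) (d∅ x)

  remove : ∀ d (I : IsInjectiveOn d f) x (dx : d x ≡ true) → P (d ∖ orbit f x (cycleLen f x)) → P d
  remove d I x dx ih e J same with matching-cycle same x dx
  ... | y , ey , ly≡lx =
    Conjugacy-glue OX.O⊆d OY.O⊆d OX.C.orbit-closed (IsInjectiveOn.into OX.rest-injective) orbits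
                   (ih (e ∖ OY.O) OY.rest-injective same-rest)
    where
    module OX = InjectiveOn.Orbit I x dx
    module OY = InjectiveOn.Orbit J y ey

    orbits : Conjugacy ⟦ OX.O ⟧ ⟦ OY.O ⟧ f g
    orbits = subst (λ m → Conjugacy ⟦ OX.O ⟧ ⟦ orbit g y m ⟧ f g) (sym ly≡lx)
                   (cycles-conjugate (InjectiveOn.isCycle I x dx) (subst (IsCycle g y) ly≡lx (InjectiveOn.isCycle J y ey)))

    same-rest : ∀ k → count (onCyclesOfLen (d ∖ OX.O) f k) ≡ count (onCyclesOfLen (e ∖ OY.O) g k)
    same-rest k = +-cancelʳ-≡ _ _ _ (begin
      count (onCyclesOfLen (d ∖ OX.O) f k) + (if does (OX.m ≟ⁿ k) then k else 0) ≡⟨ OX.countOnCycles-rest k ⟨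
      count (onCyclesOfLen d f k)                                                ≡⟨ same k ⟩
      count (onCyclesOfLen e g k)                                                ≡⟨ OY.countOnCycles-rest k ⟩
      count (onCyclesOfLen (e ∖ OY.O) g k) + (if does (OY.m ≟ⁿ k) then k else 0) ≡⟨ cong (λ m → _ + (if does (m ≟ⁿ k) then k else 0)) ly≡lx ⟩
      count (onCyclesOfLen (e ∖ OY.O) g k) + (if does (OX.m ≟ⁿ k) then k else 0) ∎)
      where open ≡-Reasoning

countOnCycles-multiple : ∀ {n} {d : Fin n → Bool} {f : Fin n → Fin n} → IsInjectiveOn d f →
                         ∀ k → ∃ λ c → count (onCyclesOfLen d f k) ≡ c * k
countOnCycles-multiple {n} {d} {f} I k = orbit-induction P empty remove d I
  where
  P : (Fin n → Bool) → Set
  P d = ∃ λ c → count (onCyclesOfLen d f k) ≡ c * k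

  empty : ∀ d → (∀ z → d z ≡ false) → P d
  empty d d∅ = 0 , trans (count-cong (λ z → cong (_∧ _) (d∅ z))) (count-false n)

  remove : ∀ d (I : IsInjectiveOn d f) x (dx : d x ≡ true) → P (d ∖ orbit f x (cycleLen f x)) → P d
  remove d I x dx (c , eq) = (if does (cycleLen f x ≟ⁿ k) then suc c else c) ,
    trans (InjectiveOn.Orbit.countOnCycles-rest I x dx k) (trans (cong (_+ _) eq) (*-+-if (does (cycleLen f x ≟ⁿ k)) c k))

countOnCycles-0 : ∀ {n} {d : Fin n → Bool} {f : Fin n → Fin n} → IsInjectiveOn d f →
                  count (onCyclesOfLen d f 0) ≡ 0
countOnCycles-0 {n} {d} {f} I = trans (count-cong no-fixed-length) (count-false n)
  where
  no-fixed-length : ∀ z → onCyclesOfLen d f 0 z ≡ false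
  no-fixed-length z with d z in dz
  ... | false = refl
  ... | true with cycleLen f z | IsCycle.nonempty (InjectiveOn.isCycle I z dz)
  ...   | suc _ | _ = refl

length-filter-tabulate : ∀ {n m ℓ} {P : Pred (Fin m) ℓ} (P? : Decidable P) (g : Fin n → Fin m) →
                         length (filter P? (tabulate g)) ≡ count (λ z → does (P? (g z)))
length-filter-tabulate {zero}  P? g = refl
length-filter-tabulate {suc n} P? g with does (P? (g zero))
... | true  = cong suc (length-filter-tabulate P? (g ∘ suc))
... | false = length-filter-tabulate P? (g ∘ suc)

does-∈? : ∀ {n} (z : Fin n) (p : Subset n) → does (z ∈? p) ≡ lookup p z
does-∈? zero    (inside  ∷ p) = refl
does-∈? zero    (outside ∷ p) = refl
does-∈? (suc z) (_ ∷ p)       = does-∈? z p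

elemsInCyclesOfLen≡count : ∀ {n} (D : Subset n) f k →
                           elemsInCyclesOfLen D f k ≡ count (onCyclesOfLen (lookup D) f k)
elemsInCyclesOfLen≡count D f k =
  trans (length-filter-tabulate (λ z → (z ∈? D) ×-dec (cycleLen f z ≟ⁿ k)) (λ z → z))
        (count-cong (λ z → cong (_∧ does (cycleLen f z ≟ⁿ k)) (does-∈? z D)))

IsPermOn⇒IsInjectiveOn : ∀ {n} {D : Subset n} {f} → IsPermOn D f → IsInjectiveOn (lookup D) f
IsPermOn⇒IsInjectiveOn {D = D} (into , injective , _) = record
  { into      = λ z dz → []=⇒lookup (into z (lookup⇒[]= z D dz))
  ; injective = λ z w dz dw → injective z w (lookup⇒[]= z D dz) (lookup⇒[]= w D dw)
  }

-- cycleType only records the counts divided by the length; they are multiples of it.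
sameCycleType⇒sameCounts : ∀ {n} {D E : Subset n} {f g} → IsPermOn D f → IsPermOn E g →
  SameCycleType D f E g → ∀ k → count (onCyclesOfLen (lookup D) f k) ≡ count (onCyclesOfLen (lookup E) g k)
sameCycleType⇒sameCounts pD pE same zero =
  trans (countOnCycles-0 (IsPermOn⇒IsInjectiveOn pD)) (sym (countOnCycles-0 (IsPermOn⇒IsInjectiveOn pE)))
sameCycleType⇒sameCounts {D = D} {E} {f} {g} pD pE same (suc k)
  with countOnCycles-multiple (IsPermOn⇒IsInjectiveOn pD) (suc k)
     | countOnCycles-multiple (IsPermOn⇒IsInjectiveOn pE) (suc k)
... | c , countD | c′ , countE = trans countD (trans (cong (_* suc k) c≡c′) (sym countE))
  where
  open ≡-Reasoning
  c≡c′ : c ≡ c′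
  c≡c′ = begin
    c                                      ≡⟨ m*n/n≡m c (suc k) ⟨
    c * suc k / suc k                      ≡⟨ cong (_/ suc k) (trans (elemsInCyclesOfLen≡count D f (suc k)) countD) ⟨
    elemsInCyclesOfLen D f (suc k) / suc k ≡⟨ same (suc k) ⟩
    elemsInCyclesOfLen E g (suc k) / suc k ≡⟨ cong (_/ suc k) (trans (elemsInCyclesOfLen≡count E g (suc k)) countE) ⟩
    c′ * suc k / suc k                     ≡⟨ m*n/n≡m c′ (suc k) ⟩
    c′                                     ∎

∣⁅a⁆∪⁅b⁆∣≡2 : ∀ {n} {a b : Fin n} → a ≢ b → ∣ ⁅ a ⁆ ∪ ⁅ b ⁆ ∣ ≡ 2
∣⁅a⁆∪⁅b⁆∣≡2 {a = zero}  {zero}  a≢b = ⊥-elim (a≢b refl)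
∣⁅a⁆∪⁅b⁆∣≡2 {a = zero}  {suc b} _   = cong suc (trans (cong ∣_∣ (∪-identityˡ ⁅ b ⁆)) (∣⁅x⁆∣≡1 b))
∣⁅a⁆∪⁅b⁆∣≡2 {a = suc a} {zero}  _   = cong suc (trans (cong ∣_∣ (∪-identityʳ ⁅ a ⁆)) (∣⁅x⁆∣≡1 a))
∣⁅a⁆∪⁅b⁆∣≡2 {a = suc a} {suc b} a≢b = ∣⁅a⁆∪⁅b⁆∣≡2 (a≢b ∘ cong suc)

∈⁅a⁆∪⁅b⁆⁻ : ∀ {n} {a b z : Fin n} → z ∈ ⁅ a ⁆ ∪ ⁅ b ⁆ → z ≡ a ⊎ z ≡ b
∈⁅a⁆∪⁅b⁆⁻ {a = a} {b} = Sum.map (x∈⁅y⁆⇒x≡y a) (x∈⁅y⁆⇒x≡y b) ∘ x∈p∪q⁻ ⁅ a ⁆ ⁅ b ⁆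

⁅a⁆∪⁅b⁆-injective : ∀ {n} {a b c d : Fin n} → a ≢ b → ⁅ a ⁆ ∪ ⁅ b ⁆ ≡ ⁅ c ⁆ ∪ ⁅ d ⁆ →
                    (a ≡ c × b ≡ d) ⊎ (a ≡ d × b ≡ c)
⁅a⁆∪⁅b⁆-injective {a = a} {b} a≢b eq
  with ∈⁅a⁆∪⁅b⁆⁻ (subst (a ∈_) eq (x∈p∪q⁺ (inj₁ (x∈⁅x⁆ a))))
     | ∈⁅a⁆∪⁅b⁆⁻ (subst (b ∈_) eq (x∈p∪q⁺ (inj₂ (x∈⁅x⁆ b))))
... | inj₁ refl | inj₁ refl = ⊥-elim (a≢b refl)
... | inj₁ a≡c  | inj₂ b≡d  = inj₁ (a≡c , b≡d)
... | inj₂ a≡d  | inj₁ b≡c  = inj₂ (a≡d , b≡c)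
... | inj₂ refl | inj₂ refl = ⊥-elim (a≢b refl)

x∈p⇒1≤∣p∣ : ∀ {n} {p : Subset n} {x} → x ∈ p → 1 ≤ ∣ p ∣
x∈p⇒1≤∣p∣ {p = p} {x} x∈p = subst (_≤ ∣ p ∣) (∣⁅x⁆∣≡1 x) (p⊆q⇒∣p∣≤∣q∣ λ y∈⁅x⁆ → subst (_∈ p) (sym (x∈⁅y⁆⇒x≡y x y∈⁅x⁆)) x∈p)

∣p∣≡1⇒unique : ∀ {n} {p : Subset n} {x y} → ∣ p ∣ ≡ 1 → x ∈ p → y ∈ p → x ≡ y
∣p∣≡1⇒unique {p = p} {x} {y} one x∈p y∈p with x ≟ᶠ y
... | yes x≡y = x≡y
... | no x≢y = ⊥-elim (<-irrefl refl (≤-<-trans (x∈p⇒1≤∣p∣ (x∈p∧x≢y⇒x∈p-y y∈p (x≢y ∘ sym)))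
                                                (subst (∣ p - x ∣ <_) one (x∈p⇒∣p-x∣<∣p∣ x∈p))))

x∈p─q⇒x∉q : ∀ {n} (p q : Subset n) {x} → x ∈ p ─ q → x ∉ q
x∈p─q⇒x∉q (inside ∷ p) (outside ∷ q) here ()
x∈p─q⇒x∉q (_ ∷ p) (_ ∷ q) (there x∈) (there x∈q) = x∈p─q⇒x∉q p q x∈ x∈q

Empty[p-x]⇒p⊆⁅x⁆ : ∀ {n} {p : Subset n} {x} → Empty (p - x) → p ⊆ ⁅ x ⁆
Empty[p-x]⇒p⊆⁅x⁆ {x = x} empty {z} z∈p with z ≟ᶠ x
... | yes refl = x∈⁅x⁆ z
... | no z≢x   = ⊥-elim (empty (z , x∈p∧x≢y⇒x∈p-y z∈p z≢x))

∣p∣≡2⇒p≡⁅a⁆∪⁅b⁆ : ∀ {n} {s : Subset n} → ∣ s ∣ ≡ 2 → ∃₂ λ a b → a ≢ b × s ≡ ⁅ a ⁆ ∪ ⁅ b ⁆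
∣p∣≡2⇒p≡⁅a⁆∪⁅b⁆ {n} {s} two with nonempty? s
... | no s-empty with () ← trans (sym two) (trans (cong ∣_∣ (Empty-unique s-empty)) (∣⊥∣≡0 n))
... | yes (a , a∈s) with nonempty? (s - a)
...   | no rest-empty with s≤s () ← subst₂ _≤_ two (∣⁅x⁆∣≡1 a) (p⊆q⇒∣p∣≤∣q∣ (Empty[p-x]⇒p⊆⁅x⁆ rest-empty))
...   | yes (b , b∈s-a) = a , b , a≢b , ⊆-antisym s⊆ ⊇s
  where
  one : ∣ s - a ∣ ≡ 1
  one = ≤-antisym (≤-pred (subst (∣ s - a ∣ <_) two (x∈p⇒∣p-x∣<∣p∣ a∈s))) (x∈p⇒1≤∣p∣ b∈s-a)
  a≢b : a ≢ b
  a≢b refl = x∈p─q⇒x∉q s ⁅ a ⁆ b∈s-a (x∈⁅x⁆ a)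
  s⊆ : s ⊆ ⁅ a ⁆ ∪ ⁅ b ⁆
  s⊆ {z} z∈s with z ≟ᶠ a
  ... | yes refl = x∈p∪q⁺ (inj₁ (x∈⁅x⁆ z))
  ... | no z≢a   = x∈p∪q⁺ (inj₂ (subst (_∈ ⁅ b ⁆) (sym (∣p∣≡1⇒unique one (x∈p∧x≢y⇒x∈p-y z∈s z≢a) b∈s-a)) (x∈⁅x⁆ b)))
  ⊇s : ⁅ a ⁆ ∪ ⁅ b ⁆ ⊆ s
  ⊇s z∈ with ∈⁅a⁆∪⁅b⁆⁻ z∈
  ... | inj₁ refl = a∈s
  ... | inj₂ refl = p─q⊆p s ⁅ a ⁆ b∈s-a

-- A 2-subset {x_j, x_i}, i < j, is recorded by its positions (j - 1, i - 1).
Pairs : ℕ → Set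
Pairs n = Σ (Fin n) λ q → Σ (Fin n) λ p → toℕ p < toℕ q

Pairs-≡ : ∀ {n} {q q′ p p′ : Fin n} {l : toℕ p < toℕ q} {l′ : toℕ p′ < toℕ q′} →
          q ≡ q′ → p ≡ p′ → _≡_ {A = Pairs n} (q , p , l) (q′ , p′ , l′)
Pairs-≡ {l = l} {l′} refl refl = cong (λ l → _ , _ , l) (<-irrelevant l l′)

℘₂-≡ : ∀ {n} {s t : ℘₂ n} → proj₁ s ≡ proj₁ t → s ≡ t
℘₂-≡ {s = s , ∣s∣≡2} {t , ∣t∣≡2} refl = cong (s ,_) (≡-irrelevant ∣s∣≡2 ∣t∣≡2)

module Encoding {n} (x : Fin n ↔ Fin n) where
  open Inverse x using () renaming (to to x→; from to x⁻¹; strictlyInverseˡ to x∘x⁻¹; strictlyInverseʳ to x⁻¹∘x)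

  x-injective : ∀ {p q} → x→ p ≡ x→ q → p ≡ q
  x-injective {p} {q} eq = trans (sym (x⁻¹∘x p)) (trans (cong x⁻¹ eq) (x⁻¹∘x q))

  x≢ : ∀ {p q} → toℕ p < toℕ q → x→ q ≢ x→ p
  x≢ p<q = <⇒≢ p<q ∘ cong toℕ ∘ sym ∘ x-injective

  encode : Pairs n → ℘₂ n
  encode (q , p , p<q) = ⁅ x→ q ⁆ ∪ ⁅ x→ p ⁆ , ∣⁅a⁆∪⁅b⁆∣≡2 (x≢ p<q)

  encode-injective : ∀ {t u} → encode t ≡ encode u → t ≡ u
  encode-injective {q , p , p<q} {q′ , p′ , p′<q′} eq with ⁅a⁆∪⁅b⁆-injective (x≢ p<q) (cong proj₁ eq)
  ... | inj₁ (q≡q′ , p≡p′) = Pairs-≡ (x-injective q≡q′) (x-injective p≡p′)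
  ... | inj₂ (q≡p′ , p≡q′) =
    ⊥-elim (<-asym p<q (subst₂ (λ a b → toℕ a < toℕ b) (sym (x-injective q≡p′)) (sym (x-injective p≡q′)) p′<q′))

  encode-surjective : ∀ s → ∃ λ t → encode t ≡ s
  encode-surjective (s , ∣s∣≡2) with ∣p∣≡2⇒p≡⁅a⁆∪⁅b⁆ {s = s} ∣s∣≡2
  ... | a , b , a≢b , s≡ab with <-cmp (toℕ (x⁻¹ a)) (toℕ (x⁻¹ b))
  ...   | tri< a<b _ _ = (x⁻¹ b , x⁻¹ a , a<b) , ℘₂-≡ (begin
    ⁅ x→ (x⁻¹ b) ⁆ ∪ ⁅ x→ (x⁻¹ a) ⁆ ≡⟨ cong₂ (λ u v → ⁅ u ⁆ ∪ ⁅ v ⁆) (x∘x⁻¹ b) (x∘x⁻¹ a) ⟩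
    ⁅ b ⁆ ∪ ⁅ a ⁆                   ≡⟨ ∪-comm ⁅ b ⁆ ⁅ a ⁆ ⟩
    ⁅ a ⁆ ∪ ⁅ b ⁆                   ≡⟨ s≡ab ⟨
    s                               ∎)
    where open ≡-Reasoning
  ...   | tri≈ _ a≡b _ = ⊥-elim (a≢b (trans (sym (x∘x⁻¹ a)) (trans (cong x→ (Finₚ.toℕ-injective a≡b)) (x∘x⁻¹ b))))
  ...   | tri> _ _ b<a = (x⁻¹ a , x⁻¹ b , b<a) ,
    ℘₂-≡ (trans (cong₂ (λ u v → ⁅ u ⁆ ∪ ⁅ v ⁆) (x∘x⁻¹ a) (x∘x⁻¹ b)) (sym s≡ab))

  Pairs↔℘₂ : Pairs n ↔ ℘₂ n
  Pairs↔℘₂ = ⤖⇒↔ (mk⤖ (encode-injective , strictlySurjective⇒surjective encode-surjective))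

Below : ∀ {n} → ℕ → Fin n → Set
Below t p = toℕ p < t

StaysBelow : ∀ {n} → (ℕ → Fin n → Fin n) → Set
StaysBelow {n} A = ∀ t → suc t ≤ n → ∀ p → Below t p → Below t (A t p)

fibreMap : ∀ {n} (A : ℕ → Fin n → Fin n) → StaysBelow A → Pairs n → Pairs n
fibreMap A A< (q , p , p<q) = q , A (toℕ q) p , A< (toℕ q) (Finₚ.toℕ<n q) p p<q

fibreMap-conjugate : ∀ {n} {A B : ℕ → Fin n → Fin n} (A< : StaysBelow A) (B< : StaysBelow B) →
  (∀ t → suc t ≤ n → Conjugacy (Below t) (Below t) (A t) (B t)) →
  Σ (Pairs n ↔ Pairs n) λ R → ∀ u → Inverse.to R (fibreMap A A< u) ≡ fibreMap B B< (Inverse.to R u)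
fibreMap-conjugate {n} {A} {B} A< B< C =
  mk↔ₛ′ to from to∘from from∘to , λ { (q , p , p<q) → Pairs-≡ refl (Conjugacy.to-comm (C′ q) p p<q) }
  where
  C′ : ∀ q → Conjugacy (Below (toℕ q)) (Below (toℕ q)) (A (toℕ q)) (B (toℕ q))
  C′ q = C (toℕ q) (Finₚ.toℕ<n q)
  to from : Pairs n → Pairs n
  to   (q , p , p<q) = q , Conjugacy.to   (C′ q) p , Conjugacy.to-∈   (C′ q) p p<q
  from (q , p , p<q) = q , Conjugacy.from (C′ q) p , Conjugacy.from-∈ (C′ q) p p<q
  to∘from : ∀ u → to (from u) ≡ u
  to∘from (q , p , p<q) = Pairs-≡ refl (Conjugacy.to-from (C′ q) p p<q)
  from∘to : ∀ u → from (to u) ≡ u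
  from∘to (q , p , p<q) = Pairs-≡ refl (Conjugacy.from-to (C′ q) p p<q)

SameCycleType⇒Conjugacy : ∀ {n} {D E : Subset n} {f g} → IsPermOn D f → IsPermOn E g →
                          SameCycleType D f E g → Conjugacy (_∈ D) (_∈ E) f g
SameCycleType⇒Conjugacy {D = D} {E} pD pE same =
  Conjugacy-resp ([]=⇒lookup , λ {z} → lookup⇒[]= z D) ([]=⇒lookup , λ {w} → lookup⇒[]= w E)
                 (λ _ _ → refl) (λ _ _ → refl)
    (sameCycleCounts⇒Conjugacy (IsPermOn⇒IsInjectiveOn pD) (IsPermOn⇒IsInjectiveOn pE)
                               (sameCycleType⇒sameCounts pD pE same))

phiExt-≥3 : ∀ {n} (Φ : Admissible n) k z → phiExt Φ (3 + k) z ≡ phi Φ (3 + k) z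
phiExt-≥3 Φ zero    z = refl
phiExt-≥3 Φ (suc k) z = refl

-- The ordering identifies Dom(φ_j) with the positions below j - 1, i.e. with {x_1, …, x_{j-1}}.
module Ordering {n} (Φ : Admissible n) (x : Fin n → Fin n) (ord : IsOrdering Φ x) where

  x↔ : Fin n ↔ Fin n
  x↔ = ⤖⇒↔ (mk⤖ (proj₁ ord))

  open Inverse x↔ public using () renaming (from to x⁻¹; strictlyInverseˡ to x∘x⁻¹; strictlyInverseʳ to x⁻¹∘x)

  dom-mono : ∀ {i j} → 3 ≤ i → i ≤ j → j ≤ n → dom Φ i ⊆ dom Φ j
  dom-mono {i} {j} 3≤i i≤j j≤n with m≤n⇒m<n∨m≡n i≤j
  ... | inj₂ refl = id
  dom-mono {i} {suc j} 3≤i _ j<n | inj₁ (s≤s i≤j) =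
    proj₁ (proj₁ (step Φ (suc j) (s≤s (≤-trans 3≤i i≤j)) j<n)) ∘ dom-mono 3≤i i≤j (<⇒≤ j<n)

  dom-below : ∀ j → 3 ≤ j → j ≤ n → ∀ p → x p ∈ dom Φ j → suc (toℕ p) < j
  dom-below j 3≤j j≤n p xp∈ with suc (toℕ p) <? j
  ... | yes p<j = p<j
  ... | no p≮j = ⊥-elim (proj₂ ord p (≤-trans 3≤j j≤p) (dom-mono 3≤j j≤p (Finₚ.toℕ<n p) xp∈))
    where j≤p = ≮⇒≥ p≮j

  -- x_j is the only point of {x_1, …, x_j} outside Dom(φ_j), so a singleton containing all such points is {x_j}.
  below-from-singleton : ∀ j → 3 ≤ j → j ≤ n → (S : Subset n) → ∣ S ∣ ≡ 1 →
    (∀ p → suc (toℕ p) ≤ j → x p ∉ dom Φ j → x p ∈ S) → ∀ p → suc (toℕ p) < j → x p ∈ dom Φ j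
  below-from-singleton j 3≤j j≤n S one caught p p<j with x p ∈? dom Φ j
  ... | yes xp∈ = xp∈
  ... | no  xp∉ = ⊥-elim (<-irrefl (trans (cong (suc ∘ toℕ) p≡q) q≡j) p<j)
    where
    suc-pred : ∀ {j} → 3 ≤ j → suc (pred j) ≡ j
    suc-pred (s≤s _) = refl
    pred-j<n : pred j < n
    pred-j<n = subst (_≤ n) (sym (suc-pred 3≤j)) j≤n
    q : Fin n
    q = fromℕ< pred-j<n
    q≡j : suc (toℕ q) ≡ j
    q≡j = trans (cong suc (Finₚ.toℕ-fromℕ< pred-j<n)) (suc-pred 3≤j)
    xq∉ : x q ∉ dom Φ j
    xq∉ = subst (λ i → x q ∉ dom Φ i) q≡j (proj₂ ord q (subst (3 ≤_) (sym q≡j) 3≤j))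
    p≡q : p ≡ q
    p≡q = proj₁ (proj₁ ord) (∣p∣≡1⇒unique one (caught p (<⇒≤ p<j) xp∉)
             (caught q (subst (_≤ j) (sym q≡j) ≤-refl) xq∉))

  dom-above : ∀ j → 3 ≤ j → j ≤ n → ∀ p → suc (toℕ p) < j → x p ∈ dom Φ j
  dom-above j 3≤j j≤n = go (n ∸ j) j (m∸n+n≡m j≤n) 3≤j
    where
    go : ∀ t j → t + j ≡ n → 3 ≤ j → ∀ p → suc (toℕ p) < j → x p ∈ dom Φ j
    go zero    j refl 3≤j = below-from-singleton j 3≤j ≤-refl (∁ (dom Φ j)) (top Φ) (λ _ _ → x∉p⇒x∈∁p)
    go (suc t) j t+j≡n 3≤j = below-from-singleton j 3≤j (<⇒≤ j<n) (dom Φ (suc j) ─ dom Φ j)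
      (proj₂ (step Φ (suc j) (s≤s 3≤j) j<n))
      (λ p p≤j → x∈p∧x∉q⇒x∈p─q (go t (suc j) (trans (+-suc t j) t+j≡n) (≤-trans 3≤j (n≤1+n j)) p (s≤s p≤j)))
      where
      j<n : suc j ≤ n
      j<n = subst (suc j ≤_) (trans (+-suc t j) t+j≡n) (m≤n+m (suc j) t)

  -- φ_(t+1) acting on positions; position p holds x_(p+1), and φ_2 is the identity.
  levelMap : ℕ → Fin n → Fin n
  levelMap t p = x⁻¹ (phiExt Φ (suc t) (x p))

  levelMap-below : StaysBelow levelMap
  levelMap-below (suc zero)    _   p p<1 = subst (λ q → toℕ q < 1) (sym (x⁻¹∘x p)) p<1
  levelMap-below (suc (suc k)) j≤n p p<t = ≤-pred (dom-below (3 + k) (m≤m+n 3 k) j≤n _ image∈)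
    where
    image∈ : x (levelMap (2 + k) p) ∈ dom Φ (3 + k)
    image∈ = subst (_∈ dom Φ (3 + k)) (sym (trans (x∘x⁻¹ _) (phiExt-≥3 Φ k (x p))))
      (proj₁ (perm Φ (3 + k) (m≤m+n 3 k) j≤n) (x p) (dom-above (3 + k) (m≤m+n 3 k) j≤n p (s≤s p<t)))

  below⇔dom : ∀ k → 3 + k ≤ n → Below (2 + k) ≐ (λ p → x p ∈ dom Φ (3 + k))
  below⇔dom k j≤n = (λ {p} p<t → dom-above (3 + k) 3≤j j≤n p (s≤s p<t))
                  , (λ {p} xp∈ → ≤-pred (dom-below (3 + k) 3≤j j≤n p xp∈))
    where
    3≤j : 3 ≤ 3 + k
    3≤j = m≤m+n 3 k

  open Encoding x↔

  σ-encode : ∀ σ → IsSigma Φ x σ → ∀ t → σ (encode t) ≡ encode (fibreMap levelMap levelMap-below t)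
  σ-encode σ isσ (q , p , p<q) =
    ℘₂-≡ (trans (isσ p q p<q _ refl) (cong (λ w → ⁅ x q ⁆ ∪ ⁅ w ⁆) (sym (x∘x⁻¹ _))))

levelMap-conjugate : ∀ {n} {Φ′ Φ″ : Admissible n} →
  (∀ j → 3 ≤ j → j ≤ n → SameCycleType (dom Φ′ j) (phi Φ′ j) (dom Φ″ j) (phi Φ″ j)) →
  ∀ {x′ x″} (o′ : IsOrdering Φ′ x′) (o″ : IsOrdering Φ″ x″) →
  ∀ t → suc t ≤ n → Conjugacy (Below t) (Below t) (Ordering.levelMap Φ′ x′ o′ t) (Ordering.levelMap Φ″ x″ o″ t)
levelMap-conjugate {Φ′ = Φ′} {Φ″} _ {x′} {x″} o′ o″ zero _ =
  Conjugacy-id (λ p _ → Ordering.x⁻¹∘x Φ′ x′ o′ p) (λ p _ → Ordering.x⁻¹∘x Φ″ x″ o″ p)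
levelMap-conjugate {Φ′ = Φ′} {Φ″} _ {x′} {x″} o′ o″ (suc zero) _ =
  Conjugacy-id (λ p _ → Ordering.x⁻¹∘x Φ′ x′ o′ p) (λ p _ → Ordering.x⁻¹∘x Φ″ x″ o″ p)
levelMap-conjugate {Φ′ = Φ′} {Φ″} same {x′} {x″} o′ o″ (suc (suc k)) j≤n =
  Conjugacy-resp (L.below⇔dom k j≤n) (R.below⇔dom k j≤n)
    (λ p _ → cong L.x⁻¹ (phiExt-≥3 Φ′ k (x′ p))) (λ p _ → cong R.x⁻¹ (phiExt-≥3 Φ″ k (x″ p)))
    (Conjugacy-relabel L.x↔ R.x↔
      (SameCycleType⇒Conjugacy (perm Φ′ (3 + k) 3≤j j≤n) (perm Φ″ (3 + k) 3≤j j≤n) (same (3 + k) 3≤j j≤n)))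
  where
  module L = Ordering Φ′ x′ o′
  module R = Ordering Φ″ x″ o″
  3≤j : 3 ≤ 3 + k
  3≤j = m≤m+n 3 k

lemma2p5 : (n : ℕ) → 3 ≤ n → (Φ′ Φ″ : Admissible n) →
    (∀ j → 3 ≤ j → j ≤ n → SameCycleType (dom Φ′ j) (phi Φ′ j) (dom Φ″ j) (phi Φ″ j)) →
    (x′ x″ : Fin n → Fin n) → IsOrdering Φ′ x′ → IsOrdering Φ″ x″ →
    (σ′ σ″ : ℘₂ n → ℘₂ n) → IsSigma Φ′ x′ σ′ → IsSigma Φ″ x″ σ″ →
    Σ (℘₂ n ↔ ℘₂ n) (λ Γ → ∀ s → σ″ (Inverse.to Γ s) ≡ Inverse.to Γ (σ′ s))
lemma2p5 n _ Φ′ Φ″ same x′ x″ o′ o″ σ′ σ″ isσ′ isσ″ = Γ , commute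
  where
  module L = Ordering Φ′ x′ o′
  module R = Ordering Φ″ x″ o″
  E′ E″ : Pairs n ↔ ℘₂ n
  E′ = Encoding.Pairs↔℘₂ L.x↔
  E″ = Encoding.Pairs↔℘₂ R.x↔
  S′ S″ : Pairs n → Pairs n
  S′ = fibreMap L.levelMap L.levelMap-below
  S″ = fibreMap R.levelMap R.levelMap-below
  ρ : Σ (Pairs n ↔ Pairs n) λ ρ → ∀ u → Inverse.to ρ (S′ u) ≡ S″ (Inverse.to ρ u)
  ρ = fibreMap-conjugate L.levelMap-below R.levelMap-below (levelMap-conjugate {Φ′ = Φ′} {Φ″} same o′ o″)
  module E′ = Inverse E′
  module E″ = Inverse E″
  module ρ = Inverse (proj₁ ρ)

  Γ : ℘₂ n ↔ ℘₂ n
  Γ = E″ ↔-∘ (proj₁ ρ ↔-∘ ↔-sym E′)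

  commute : ∀ s → σ″ (Inverse.to Γ s) ≡ Inverse.to Γ (σ′ s)
  commute s = begin
    σ″ (E″.to (ρ.to u))                  ≡⟨ R.σ-encode σ″ isσ″ (ρ.to u) ⟩
    E″.to (S″ (ρ.to u))                  ≡⟨ cong E″.to (proj₂ ρ u) ⟨
    E″.to (ρ.to (S′ u))                  ≡⟨ cong (E″.to ∘ ρ.to) (E′.strictlyInverseʳ (S′ u)) ⟨
    E″.to (ρ.to (E′.from (E′.to (S′ u)))) ≡⟨ cong (E″.to ∘ ρ.to ∘ E′.from) (L.σ-encode σ′ isσ′ u) ⟨
    E″.to (ρ.to (E′.from (σ′ (E′.to u)))) ≡⟨ cong (E″.to ∘ ρ.to ∘ E′.from ∘ σ′) (E′.strictlyInverseˡ s) ⟩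
    E″.to (ρ.to (E′.from (σ′ s)))         ∎
    where
    open ≡-Reasoning
    u : Pairs n
    u = E′.from s
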